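{- Let $t\ge0$ be an integer. If a graph $G$ is $t$-minor-balanced, then $G^+$ is $(t+1)$-minor-balanced, where $G^+$ is obtained from $G$ by adding a new vertex adjacent to all vertices of $G$.
   Context: All graphs are finite and simple. For an integer $s\ge0$, the $s$-density is $\rho_s(G)=\dfrac{e(G)-\binom{s}{2}}{v(G)-s}$ if $e(G)>\binom{s}{2}$, and $\rho_s(G)=0$ otherwise. A graph $G$ is $s$-minor-balanced if $\rho_s(G)>0$ and $\rho_s(G)\geq\rho_s(H)$ for every minor $H$ of $G$. -}

module Defs where

open import Data.Nat using (ℕ; zero; suc; _∸_; _<ᵇ_; _<?_)
open import Data.Nat.Combinatorics using (_C_)
open import Data.Bool using (Bool; true; false; _∧_; if_then_else_)
open import Data.Fin using (Fin; zero; suc; toℕ)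
open import Data.List using (List; map; allFin)
open import Data.Nat.ListAction using (sum)
open import Data.Maybe using (Maybe; just)
open import Data.Product using (Σ; ∃; ∃-syntax; _×_)
open import Data.Integer using (+_)
open import Data.Rational using (ℚ; _/_; 0ℚ; _<_; _≤_)
open import Relation.Binary.PropositionalEquality using (_≡_)
open import Relation.Nullary using (yes; no)

record Graph : Set where
  field
    n      : ℕ
    adj    : Fin n → Fin n → Bool
    sym    : ∀ i j → adj i j ≡ adj j i
    irrefl : ∀ i → adj i i ≡ false
open Graph public

vcount : Graph → ℕ
vcount G = n G

ecount : Graph → ℕ
ecount G = sum (map (λ i → sum (map (λ j →
             if (toℕ i <ᵇ toℕ j) ∧ adj G i j then 1 else 0)
             (allFin (n G)))) (allFin (n G)))

-- s-density ρ_s(G).  (When e(G) > C(s,2) one always has v(G) > s; the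
-- branch v(G) ∸ s = 0 is therefore unreachable and is set to 0.)
rho : ℕ → Graph → ℚ
rho s G with (s C 2) <? ecount G | vcount G ∸ s
... | yes _ | suc k = (+ (ecount G ∸ (s C 2))) / suc k
... | yes _ | zero  = 0ℚ
... | no _  | _     = 0ℚ

data Reach (G : Graph) (P : Fin (n G) → Set) : Fin (n G) → Fin (n G) → Set where
  here : ∀ {x} → P x → Reach G P x x
  step : ∀ {x y z} → Reach G P x y → adj G y z ≡ true → P z → Reach G P x z

-- Branch sets are encoded by φ : V(G) → Maybe V(H), B_v = φ⁻¹(just v).
record IsMinor (H G : Graph) : Set where
  field
    φ         : Fin (n G) → Maybe (Fin (n H))
    nonempty  : ∀ v → ∃[ x ] (φ x ≡ just v)
    connected : ∀ v x y → φ x ≡ just v → φ y ≡ just v →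
                Reach G (λ z → φ z ≡ just v) x y
    edges     : ∀ u w → adj H u w ≡ true →
                ∃[ x ] ∃[ y ] (φ x ≡ just u × φ y ≡ just w × adj G x y ≡ true)

MinorBalanced : ℕ → Graph → Set
MinorBalanced s G = (0ℚ < rho s G) × (∀ (H : Graph) → IsMinor H G → rho s H ≤ rho s G)

plusAdj : (G : Graph) → Fin (suc (n G)) → Fin (suc (n G)) → Bool
plusAdj G zero    zero    = false
plusAdj G zero    (suc j) = true
plusAdj G (suc i) zero    = true
plusAdj G (suc i) (suc j) = adj G i j

plusSym : (G : Graph) → ∀ i j → plusAdj G i j ≡ plusAdj G j i
plusSym G zero    zero    = Relation.Binary.PropositionalEquality.refl
plusSym G zero    (suc j) = Relation.Binary.PropositionalEquality.refl
plusSym G (suc i) zero    = Relation.Binary.PropositionalEquality.refl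
plusSym G (suc i) (suc j) = sym G i j

plusIrr : (G : Graph) → ∀ i → plusAdj G i i ≡ false
plusIrr G zero    = Relation.Binary.PropositionalEquality.refl
plusIrr G (suc i) = irrefl G i

_⁺ : Graph → Graph
G ⁺ = record { n = suc (n G) ; adj = plusAdj G ; sym = plusSym G ; irrefl = plusIrr G }

-- Adding the apex adds v(G) edges, and C(t+1,2) = C(t,2) + t, so ρ_{t+1}(G⁺) = ρ_t(G) + 1.
-- Conversely, let H be a minor of G⁺ and r the vertex of H whose branch set contains the
-- apex (any vertex if none does). Then H − r is a minor of G, and H has at most v(H) − 1
-- more edges than H − r, so ρ_{t+1}(H) ≤ ρ_t(H − r) + 1 ≤ ρ_t(G) + 1.
module Submission where

open import Defs hiding (sym)
open import Data.Nat as ℕ using (ℕ; zero; suc; _+_; _∸_; _<ᵇ_; _<?_; z≤n; s≤s)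
import Data.Nat.Properties as ℕP
open import Data.Nat.Combinatorics using (_C_; nC1≡n; nCk+nC[k+1]≡[n+1]C[k+1])
open import Data.Nat.ListAction using (sum)
open import Data.Nat.Solver using (module +-*-Solver)
open import Data.Bool using (Bool; true; false; _∧_; if_then_else_)
open import Data.Fin using (Fin; zero; suc; toℕ; punchIn; punchOut; _≟_)
open import Data.Fin.Properties using (punchInᵢ≢i; punchOut-cong; punchOut-punchIn; punchIn-punchOut)
open import Data.List using (map; allFin; tabulate)
open import Data.List.Properties using (map-tabulate)
open import Data.Maybe using (Maybe; just; nothing)
open import Data.Maybe.Properties using (just-injective)
open import Data.Product using (Σ-syntax; ∃-syntax; _×_; _,_)
open import Data.Integer as ℤ using (+_; 1ℤ)
import Data.Integer.Properties as ℤP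
import Data.Integer.Solver as ℤSolver
open import Data.Rational as ℚ using (_/_; 0ℚ; 1ℚ; _≤_; _<_; toℚᵘ)
import Data.Rational.Properties as ℚP
import Data.Rational.Unnormalised as ℚᵘ
import Data.Rational.Unnormalised.Properties as ℚᵘP
open import Algebra.Properties.CommutativeMonoid.Sum ℕP.+-0-commutativeMonoid
  using (sum-syntax; sum-remove; ∑-distrib-+; sum-cong-≗)
open import Function using (id; _∘_)
open import Relation.Binary.PropositionalEquality
open import Relation.Nullary using (¬_; yes; no)
open import Data.Empty using (⊥-elim)

sum-tabulate : ∀ n (f : Fin n → ℕ) → sum (tabulate f) ≡ ∑[ i < n ] f i
sum-tabulate zero    f = refl
sum-tabulate (suc n) f = cong (_+_ (f zero)) (sum-tabulate n (f ∘ suc))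

sum-map-allFin : ∀ n (f : Fin n → ℕ) → sum (map f (allFin n)) ≡ ∑[ i < n ] f i
sum-map-allFin n f = trans (cong sum (map-tabulate id f)) (sum-tabulate n f)

∑-const-1 : ∀ n → ∑[ i < n ] 1 ≡ n
∑-const-1 zero    = refl
∑-const-1 (suc n) = cong suc (∑-const-1 n)

∑-≤1⇒≤n : ∀ n (f : Fin n → ℕ) → (∀ i → f i ℕ.≤ 1) → ∑[ i < n ] f i ℕ.≤ n
∑-≤1⇒≤n zero    f f≤1 = z≤n
∑-≤1⇒≤n (suc n) f f≤1 = ℕP.+-mono-≤ (f≤1 zero) (∑-≤1⇒≤n n (f ∘ suc) (f≤1 ∘ suc))

∑∑-removeAt : ∀ m (r : Fin (suc m)) (g : Fin (suc m) → Fin (suc m) → ℕ) →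
  ∑[ i < suc m ] ∑[ j < suc m ] g i j ≡
  g r r + ∑[ i < m ] (g (punchIn r i) r + g r (punchIn r i))
        + ∑[ i < m ] ∑[ j < m ] g (punchIn r i) (punchIn r j)
∑∑-removeAt m r g = begin
  ∑[ i < suc m ] ∑[ j < suc m ] g i j
    ≡⟨ sum-cong-≗ (λ i → sum-remove {i = r} (g i)) ⟩
  ∑[ i < suc m ] (g i r + ∑[ j < m ] g i (punchIn r j))
    ≡⟨ ∑-distrib-+ (λ i → g i r) (λ i → ∑[ j < m ] g i (punchIn r j)) ⟩
  ∑[ i < suc m ] g i r + ∑[ i < suc m ] ∑[ j < m ] g i (punchIn r j)
    ≡⟨ cong₂ _+_ (sum-remove {i = r} (λ i → g i r))
                 (sum-remove {i = r} (λ i → ∑[ j < m ] g i (punchIn r j))) ⟩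
  (g r r + column) + (row + rest)
    ≡⟨ regroup (g r r) column row rest ⟩
  g r r + (column + row) + rest
    ≡⟨ cong (λ x → g r r + x + rest) (∑-distrib-+ (λ i → g (punchIn r i) r) (λ i → g r (punchIn r i))) ⟨
  g r r + ∑[ i < m ] (g (punchIn r i) r + g r (punchIn r i)) + rest ∎
  where
  open ≡-Reasoning
  open +-*-Solver
  column = ∑[ i < m ] g (punchIn r i) r
  row    = ∑[ j < m ] g r (punchIn r j)
  rest   = ∑[ i < m ] ∑[ j < m ] g (punchIn r i) (punchIn r j)
  regroup : ∀ a b c d → (a + b) + (c + d) ≡ a + (b + c) + d
  regroup = solve 4 (λ a b c d → (a :+ b) :+ (c :+ d) := a :+ (b :+ c) :+ d) refl

<ᵇ-irrefl : ∀ m → (m <ᵇ m) ≡ false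
<ᵇ-irrefl zero    = refl
<ᵇ-irrefl (suc m) = <ᵇ-irrefl m

<ᵇ-asym : ∀ m n → (m <ᵇ n) ≡ true → (n <ᵇ m) ≡ false
<ᵇ-asym zero    (suc n) _ = refl
<ᵇ-asym (suc m) (suc n) e = <ᵇ-asym m n e

toℕ-punchIn-<ᵇ : ∀ {m} (r : Fin (suc m)) (i j : Fin m) →
                 (toℕ (punchIn r i) <ᵇ toℕ (punchIn r j)) ≡ (toℕ i <ᵇ toℕ j)
toℕ-punchIn-<ᵇ zero    i       j       = refl
toℕ-punchIn-<ᵇ (suc r) zero    zero    = refl
toℕ-punchIn-<ᵇ (suc r) zero    (suc j) = refl
toℕ-punchIn-<ᵇ (suc r) (suc i) zero    = refl
toℕ-punchIn-<ᵇ (suc r) (suc i) (suc j) = toℕ-punchIn-<ᵇ r i j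

upperEdge : ∀ {m} → (Fin m → Fin m → Bool) → Fin m → Fin m → ℕ
upperEdge a i j = if (toℕ i <ᵇ toℕ j) ∧ a i j then 1 else 0

ecount≡∑∑ : ∀ G → ecount G ≡ ∑[ i < n G ] ∑[ j < n G ] upperEdge (adj G) i j
ecount≡∑∑ G = trans (sum-map-allFin (n G) _) (sum-cong-≗ (λ i → sum-map-allFin (n G) (upperEdge (adj G) i)))

upperEdge-punchIn : ∀ {m} (a : Fin (suc m) → Fin (suc m) → Bool) r i j →
                    upperEdge a (punchIn r i) (punchIn r j) ≡ upperEdge (λ i j → a (punchIn r i) (punchIn r j)) i j
upperEdge-punchIn a r i j =
  cong (λ b → if b ∧ a (punchIn r i) (punchIn r j) then 1 else 0) (toℕ-punchIn-<ᵇ r i j)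

upperEdge-diag : ∀ {m} (a : Fin m → Fin m → Bool) i → upperEdge a i i ≡ 0
upperEdge-diag a i rewrite <ᵇ-irrefl (toℕ i) = refl

if-≤1 : ∀ b → (if b then 1 else 0) ℕ.≤ 1
if-≤1 true  = s≤s z≤n
if-≤1 false = z≤n

upperEdge-pair : ∀ {m} (a : Fin m → Fin m → Bool) i j → upperEdge a i j + upperEdge a j i ℕ.≤ 1
upperEdge-pair a i j with toℕ i <ᵇ toℕ j in i<j | toℕ j <ᵇ toℕ i in j<i
... | false | b     = if-≤1 (b ∧ a j i)
... | true  | false = subst (ℕ._≤ 1) (sym (ℕP.+-identityʳ _)) (if-≤1 (a i j))
... | true  | true  with trans (sym j<i) (<ᵇ-asym (toℕ i) (toℕ j) i<j)
... | ()

ecount-⁺ : ∀ G → ecount (G ⁺) ≡ ecount G + n G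
ecount-⁺ G = begin
  ecount (G ⁺)
    ≡⟨ ecount≡∑∑ (G ⁺) ⟩
  ∑[ i < suc (n G) ] ∑[ j < suc (n G) ] upperEdge (plusAdj G) i j
    ≡⟨ ∑∑-removeAt (n G) zero (upperEdge (plusAdj G)) ⟩
  ∑[ i < n G ] 1 + ∑[ i < n G ] ∑[ j < n G ] upperEdge (adj G) i j
    ≡⟨ cong₂ _+_ (∑-const-1 (n G)) (sym (ecount≡∑∑ G)) ⟩
  n G + ecount G
    ≡⟨ ℕP.+-comm (n G) (ecount G) ⟩
  ecount G + n G ∎
  where open ≡-Reasoning

removeVertex : (H : Graph) → Fin (n H) → Graph
removeVertex record { n = suc m ; adj = a ; sym = a-sym ; irrefl = a-irrefl } r = record
  { n      = m
  ; adj    = λ i j → a (punchIn r i) (punchIn r j)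
  ; sym    = λ i j → a-sym (punchIn r i) (punchIn r j)
  ; irrefl = λ i → a-irrefl (punchIn r i)
  }

ecount-removeVertex : ∀ H r → ecount H ℕ.≤ ecount (removeVertex H r) + n (removeVertex H r)
ecount-removeVertex H@record { n = suc m ; adj = a } r = begin
  ecount H
    ≡⟨ ecount≡∑∑ H ⟩
  ∑[ i < suc m ] ∑[ j < suc m ] upperEdge a i j
    ≡⟨ ∑∑-removeAt m r (upperEdge a) ⟩
  upperEdge a r r + incident + ∑[ i < m ] ∑[ j < m ] upperEdge a (punchIn r i) (punchIn r j)
    ≡⟨ cong₂ (λ x y → x + incident + y) (upperEdge-diag a r) remaining ⟩
  incident + ecount (removeVertex H r)
    ≤⟨ ℕP.+-monoˡ-≤ _ (∑-≤1⇒≤n m _ (λ i → upperEdge-pair a (punchIn r i) r)) ⟩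
  m + ecount (removeVertex H r)
    ≡⟨ ℕP.+-comm m _ ⟩
  ecount (removeVertex H r) + m ∎
  where
  open ℕP.≤-Reasoning
  incident = ∑[ i < m ] (upperEdge a (punchIn r i) r + upperEdge a r (punchIn r i))
  remaining : ∑[ i < m ] ∑[ j < m ] upperEdge a (punchIn r i) (punchIn r j) ≡ ecount (removeVertex H r)
  remaining = trans (sum-cong-≗ (λ i → sum-cong-≗ (upperEdge-punchIn a r i)))
                    (sym (ecount≡∑∑ (removeVertex H r)))

Reach-end : ∀ {G P x y} → Reach G P x y → P y
Reach-end (here p)     = p
Reach-end (step _ _ p) = p

Reach-map : ∀ {G} {P Q : Fin (n G) → Set} → (∀ {z} → P z → Q z) → ∀ {x y} → Reach G P x y → Reach G Q x y
Reach-map P⇒Q (here p)     = here (P⇒Q p)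
Reach-map P⇒Q (step r e p) = step (Reach-map P⇒Q r) e (P⇒Q p)

Reach-⁺ : ∀ {G P x y} → ¬ P zero → Reach (G ⁺) P (suc x) (suc y) → Reach G (P ∘ suc) x y
Reach-⁺ ¬P₀ (here p)                 = here p
Reach-⁺ ¬P₀ (step {y = zero} r _ _)  = ⊥-elim (¬P₀ (Reach-end r))
Reach-⁺ ¬P₀ (step {y = suc _} r e p) = step (Reach-⁺ ¬P₀ r) e p

dropBranch : ∀ {m} → Fin (suc m) → Maybe (Fin (suc m)) → Maybe (Fin m)
dropBranch r nothing = nothing
dropBranch r (just v) with r ≟ v
... | yes _   = nothing
... | no r≢v  = just (punchOut r≢v)

dropBranch-punchIn : ∀ {m} (r : Fin (suc m)) {x w} → x ≡ just (punchIn r w) → dropBranch r x ≡ just w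
dropBranch-punchIn r {w = w} refl with r ≟ punchIn r w
... | yes r≡ = ⊥-elim (punchInᵢ≢i r w (sym r≡))
... | no r≢  = cong just (trans (punchOut-cong r refl) (punchOut-punchIn r))

dropBranch-just : ∀ {m} (r : Fin (suc m)) x {w} → dropBranch r x ≡ just w → x ≡ just (punchIn r w)
dropBranch-just r (just v) e with r ≟ v
dropBranch-just r (just v) refl | no r≢v = cong just (sym (punchIn-punchOut r≢v))

apexOwner : ∀ {G H} (M : IsMinor H (G ⁺)) → Fin (n H) →
            Σ[ r ∈ Fin (n H) ] (∀ w → IsMinor.φ M zero ≡ just w → w ≡ r)
apexOwner M default with IsMinor.φ M zero
... | nothing = default , λ _ ()
... | just r  = r , λ w e → sym (just-injective e)

removeVertex-minor : ∀ {G H} (M : IsMinor H (G ⁺)) (r : Fin (n H)) →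
                     (∀ w → IsMinor.φ M zero ≡ just w → w ≡ r) → IsMinor (removeVertex H r) G
removeVertex-minor {G} {H@record { n = suc m }} M r owns = record
  { φ         = ψ
  ; nonempty  = nonempty
  ; connected = connected
  ; edges     = edges
  }
  where
  open IsMinor M using (φ)
  ψ : Fin (n G) → Maybe (Fin m)
  ψ x = dropBranch r (φ (suc x))
  apex∉ : ∀ w → ¬ (φ zero ≡ just (punchIn r w))
  apex∉ w e = punchInᵢ≢i r w (owns (punchIn r w) e)
  nonempty : ∀ w → ∃[ x ] (ψ x ≡ just w)
  nonempty w with IsMinor.nonempty M (punchIn r w)
  ... | zero  , e = ⊥-elim (apex∉ w e)
  ... | suc x , e = x , dropBranch-punchIn r e
  connected : ∀ w x y → ψ x ≡ just w → ψ y ≡ just w → Reach G (λ z → ψ z ≡ just w) x y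
  connected w x y ψx ψy = Reach-map (dropBranch-punchIn r) (Reach-⁺ (apex∉ w)
    (IsMinor.connected M (punchIn r w) (suc x) (suc y) (dropBranch-just r _ ψx) (dropBranch-just r _ ψy)))
  edges : ∀ u w → adj (removeVertex H r) u w ≡ true →
          ∃[ x ] ∃[ y ] (ψ x ≡ just u × ψ y ≡ just w × adj G x y ≡ true)
  edges u w e with IsMinor.edges M (punchIn r u) (punchIn r w) e
  ... | zero  , _     , φx , _  , _   = ⊥-elim (apex∉ u φx)
  ... | suc x , zero  , _  , φy , _   = ⊥-elim (apex∉ w φy)
  ... | suc x , suc y , φx , φy , exy = x , y , dropBranch-punchIn r φx , dropBranch-punchIn r φy , exy

[1+n]C2≡n+nC2 : ∀ n → suc n C 2 ≡ n + n C 2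
[1+n]C2≡n+nC2 n = trans (sym (nCk+nC[k+1]≡[n+1]C[k+1] n 1)) (cong (_+ n C 2) (nC1≡n n))

m∸n≡1+o⇒m≡n+1+o : ∀ m n {o} → m ∸ n ≡ suc o → m ≡ n + suc o
m∸n≡1+o⇒m≡n+1+o m n m∸n≡ = trans (sym (ℕP.m+[n∸m]≡n {n} n≤m)) (cong (_+_ n) m∸n≡)
  where
  n≤m : n ℕ.≤ m
  n≤m = ℕP.<⇒≤ (ℕP.m∸n≢0⇒n<m (λ m∸n≡0 → ℕP.1+n≢0 (trans (sym m∸n≡) m∸n≡0)))

apex-excess : ∀ t e v {k} → v ∸ t ≡ suc k → (e + v) ∸ suc t C 2 ≡ (e + suc k) ∸ t C 2
apex-excess t e v {k} v∸t≡ = begin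
  (e + v) ∸ suc t C 2              ≡⟨ cong₂ _∸_ (cong (_+_ e) (m∸n≡1+o⇒m≡n+1+o v t v∸t≡)) ([1+n]C2≡n+nC2 t) ⟩
  (e + (t + suc k)) ∸ (t + t C 2)  ≡⟨ cong (_∸ (t + t C 2)) (reorder e t (suc k)) ⟩
  (t + (e + suc k)) ∸ (t + t C 2)  ≡⟨ ℕP.[m+n]∸[m+o]≡n∸o t (e + suc k) (t C 2) ⟩
  (e + suc k) ∸ t C 2              ∎
  where
  open ≡-Reasoning
  open +-*-Solver
  reorder : ∀ e t d → e + (t + d) ≡ t + (e + d)
  reorder = solve 3 (λ e t d → e :+ (t :+ d) := t :+ (e :+ d)) refl

+-∸-≤ : ∀ e c d → (e + d) ∸ c ℕ.≤ (e ∸ c) + d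
+-∸-≤ e c d = ℕP.m≤n+o⇒m∸n≤o (e + d) c
  (subst (e + d ℕ.≤_) (ℕP.+-assoc c (e ∸ c) d) (ℕP.+-monoˡ-≤ d (ℕP.m≤n+m∸n e c)))

toℚᵘ-/ : ∀ p k → toℚᵘ (p / suc k) ℚᵘ.≃ ℚᵘ.mkℚᵘ p k
toℚᵘ-/ p k = ℚP.toℚᵘ-fromℚᵘ (ℚᵘ.mkℚᵘ p k)

/-monoˡ-≤ : ∀ {a b} k → a ℕ.≤ b → (+ a) / suc k ≤ (+ b) / suc k
/-monoˡ-≤ {a} {b} k a≤b = ℚP.toℚᵘ-cancel-≤ (begin
  toℚᵘ ((+ a) / suc k) ≃⟨ toℚᵘ-/ (+ a) k ⟩
  ℚᵘ.mkℚᵘ (+ a) k      ≤⟨ ℚᵘ.*≤* (ℤP.*-monoʳ-≤-nonNeg (+ suc k) (ℤ.+≤+ a≤b)) ⟩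
  ℚᵘ.mkℚᵘ (+ b) k      ≃⟨ ℚᵘP.≃-sym (toℚᵘ-/ (+ b) k) ⟩
  toℚᵘ ((+ b) / suc k) ∎)
  where open ℚᵘP.≤-Reasoning

/-+-denominator : ∀ a k → (+ (a + suc k)) / suc k ≡ (+ a) / suc k ℚ.+ 1ℚ
/-+-denominator a k = ℚP.toℚᵘ-injective (begin-equality
  toℚᵘ ((+ (a + suc k)) / suc k)         ≃⟨ toℚᵘ-/ _ k ⟩
  ℚᵘ.mkℚᵘ (+ (a + suc k)) k              ≃⟨ ℚᵘ.*≡* cross-multiplied ⟩
  ℚᵘ.mkℚᵘ (+ a) k ℚᵘ.+ ℚᵘ.1ℚᵘ            ≃⟨ ℚᵘP.+-congˡ ℚᵘ.1ℚᵘ (toℚᵘ-/ (+ a) k) ⟨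
  toℚᵘ ((+ a) / suc k) ℚᵘ.+ toℚᵘ 1ℚ      ≃⟨ ℚP.toℚᵘ-homo-+ ((+ a) / suc k) 1ℚ ⟨
  toℚᵘ ((+ a) / suc k ℚ.+ 1ℚ)            ∎)
  where
  open ℚᵘP.≤-Reasoning
  open ℤSolver.+-*-Solver
  a/[1+k]+1 = ℚᵘ.mkℚᵘ (+ a) k ℚᵘ.+ ℚᵘ.1ℚᵘ
  cross-multiplied : (+ (a + suc k)) ℤ.* ℚᵘ.↧ a/[1+k]+1 ≡ ℚᵘ.↥ a/[1+k]+1 ℤ.* (+ suc k)
  cross-multiplied = trans (cong (ℤ._* ℚᵘ.↧ a/[1+k]+1) (ℤP.pos-+ a (suc k)))
    (solve 2 (λ A K → (A :+ K) :* (K :* con 1ℤ) := (A :* con 1ℤ :+ con 1ℤ :* K) :* K) refl (+ a) (+ suc k))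

excess : ℕ → Graph → ℕ
excess s G = ecount G ∸ s C 2

-- If e(G) ≤ C(s,2) both sides are 0: the excess is a truncated difference.
rho-≡ : ∀ s G {k} → vcount G ∸ s ≡ suc k → rho s G ≡ (+ excess s G) / suc k
rho-≡ s G {k} v∸s≡ with (s C 2) <? ecount G | vcount G ∸ s
... | yes _    | suc _ = cong (λ d → (+ excess s G) / suc d) (ℕP.suc-injective v∸s≡)
... | no  e≯C  | suc _ =
  sym (trans (cong (λ x → (+ x) / suc k) (ℕP.m≤n⇒m∸n≡0 (ℕP.≮⇒≥ e≯C))) (ℚP.0/n≡0 (suc k)))

rho-≡0 : ∀ s G → vcount G ∸ s ≡ 0 → rho s G ≡ 0ℚ
rho-≡0 s G v∸s≡0 with (s C 2) <? ecount G | vcount G ∸ s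
... | yes _ | zero = refl
... | no _  | _    = refl

rho-pos : ∀ s G → 0ℚ < rho s G → (s C 2 ℕ.< ecount G) × ∃[ k ] (vcount G ∸ s ≡ suc k)
rho-pos s G ρ>0 with (s C 2) <? ecount G | vcount G ∸ s
... | yes C<e | suc k = C<e , k , refl
... | yes _   | zero  = ⊥-elim (ℚP.<-irrefl refl ρ>0)
... | no _    | _     = ⊥-elim (ℚP.<-irrefl refl ρ>0)

excess-⁺ : ∀ t G {k} → t C 2 ℕ.≤ ecount G → vcount G ∸ t ≡ suc k →
           excess (suc t) (G ⁺) ≡ excess t G + suc k
excess-⁺ t G {k} C≤e v∸t≡ = begin
  excess (suc t) (G ⁺)            ≡⟨ cong (_∸ suc t C 2) (ecount-⁺ G) ⟩
  (ecount G + n G) ∸ suc t C 2    ≡⟨ apex-excess t (ecount G) (n G) v∸t≡ ⟩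
  (ecount G + suc k) ∸ t C 2      ≡⟨ ℕP.+-∸-comm (suc k) C≤e ⟩
  excess t G + suc k              ∎
  where open ≡-Reasoning

excess-suc-≤ : ∀ t H K {k} → ecount H ℕ.≤ ecount K + vcount K → vcount K ∸ t ≡ suc k →
               excess (suc t) H ℕ.≤ excess t K + suc k
excess-suc-≤ t H K {k} eH≤ vK∸t≡ = begin
  excess (suc t) H                   ≤⟨ ℕP.∸-monoˡ-≤ (suc t C 2) eH≤ ⟩
  (ecount K + vcount K) ∸ suc t C 2  ≡⟨ apex-excess t (ecount K) (vcount K) vK∸t≡ ⟩
  (ecount K + suc k) ∸ t C 2         ≤⟨ +-∸-≤ (ecount K) (t C 2) (suc k) ⟩
  excess t K + suc k                 ∎
  where open ℕP.≤-Reasoning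

rho-⁺ : ∀ t G → 0ℚ < rho t G → rho (suc t) (G ⁺) ≡ rho t G ℚ.+ 1ℚ
rho-⁺ t G ρ>0 with rho-pos t G ρ>0
... | C<e , k , v∸t≡ = begin
  rho (suc t) (G ⁺)                  ≡⟨ rho-≡ (suc t) (G ⁺) v∸t≡ ⟩
  (+ excess (suc t) (G ⁺)) / suc k   ≡⟨ cong (λ x → (+ x) / suc k) (excess-⁺ t G (ℕP.<⇒≤ C<e) v∸t≡) ⟩
  (+ (excess t G + suc k)) / suc k   ≡⟨ /-+-denominator (excess t G) k ⟩
  (+ excess t G) / suc k ℚ.+ 1ℚ      ≡⟨ cong (ℚ._+ 1ℚ) (rho-≡ t G v∸t≡) ⟨
  rho t G ℚ.+ 1ℚ                     ∎
  where open ≡-Reasoning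

rho-suc-≤ : ∀ t H K → vcount H ≡ suc (vcount K) → ecount H ℕ.≤ ecount K + vcount K →
            rho (suc t) H ≤ rho t K ℚ.+ 1ℚ
rho-suc-≤ t H K vH≡ eH≤ = by-cases (vcount K ∸ t) refl
  where
  open ℚP.≤-Reasoning
  by-cases : ∀ d → vcount K ∸ t ≡ d → rho (suc t) H ≤ rho t K ℚ.+ 1ℚ
  by-cases zero vK∸t≡0 = begin
    rho (suc t) H                    ≡⟨ rho-≡0 (suc t) H (trans (cong (_∸ suc t) vH≡) vK∸t≡0) ⟩
    0ℚ                               ≤⟨ ℚP.nonNegative⁻¹ 1ℚ ⟩
    0ℚ ℚ.+ 1ℚ                        ≡⟨ cong (ℚ._+ 1ℚ) (rho-≡0 t K vK∸t≡0) ⟨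
    rho t K ℚ.+ 1ℚ                   ∎
  by-cases (suc l) vK∸t≡ = begin
    rho (suc t) H                    ≡⟨ rho-≡ (suc t) H (trans (cong (_∸ suc t) vH≡) vK∸t≡) ⟩
    (+ excess (suc t) H) / suc l     ≤⟨ /-monoˡ-≤ l (excess-suc-≤ t H K eH≤ vK∸t≡) ⟩
    (+ (excess t K + suc l)) / suc l ≡⟨ /-+-denominator (excess t K) l ⟩
    (+ excess t K) / suc l ℚ.+ 1ℚ    ≡⟨ cong (ℚ._+ 1ℚ) (rho-≡ t K vK∸t≡) ⟨
    rho t K ℚ.+ 1ℚ                   ∎

lemma3 : (t : ℕ) (G : Graph) → MinorBalanced t G → MinorBalanced (suc t) (G ⁺)
lemma3 t G (ρ>0 , maximal) = ρ⁺>0 , maximal⁺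
  where
  ρ⁺≡ : rho (suc t) (G ⁺) ≡ rho t G ℚ.+ 1ℚ
  ρ⁺≡ = rho-⁺ t G ρ>0
  ρ⁺>0 : 0ℚ < rho (suc t) (G ⁺)
  ρ⁺>0 = subst (0ℚ <_) (sym ρ⁺≡) (ℚP.+-mono-<-≤ ρ>0 (ℚP.nonNegative⁻¹ 1ℚ))
  maximal⁺ : ∀ H → IsMinor H (G ⁺) → rho (suc t) H ≤ rho (suc t) (G ⁺)
  maximal⁺ H@record { n = zero } M =
    subst (_≤ rho (suc t) (G ⁺)) (sym (rho-≡0 (suc t) H refl)) (ℚP.<⇒≤ ρ⁺>0)
  maximal⁺ H@record { n = suc _ } M with apexOwner M zero
  ... | r , owns = begin
    rho (suc t) H                    ≤⟨ rho-suc-≤ t H (removeVertex H r) refl (ecount-removeVertex H r) ⟩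
    rho t (removeVertex H r) ℚ.+ 1ℚ  ≤⟨ ℚP.+-monoˡ-≤ 1ℚ (maximal (removeVertex H r) (removeVertex-minor M r owns)) ⟩
    rho t G ℚ.+ 1ℚ                   ≡⟨ ρ⁺≡ ⟨
    rho (suc t) (G ⁺)                ∎
    where open ℚP.≤-Reasoning
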